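{- The logic $\mathbf{CL}$ is sound and complete with respect to the class of all selection L-frames: a consequence pair $\phi\trianglelefteq\psi$ belongs to $\mathbf{CL}$ if and only if it is validated by every selection L-frame.
   Context: Formulas: $\phi::=p\mid\top\mid\bot\mid\phi\wedge\phi\mid\phi\vee\phi\mid\phi\Rightarrow\phi$, $p$ from a fixed set of letters; consequence pairs are expressions $\phi\trianglelefteq\psi$. $\mathbf{CL}$ is the smallest set of consequence pairs closed under uniform substitution, containing $p\trianglelefteq\top$, $\bot\trianglelefteq p$, $p\trianglelefteq p$, $p\wedge q\trianglelefteq p$, $p\wedge q\trianglelefteq q$, $p\trianglelefteq p\vee q$, $q\trianglelefteq p\vee q$, $\top\trianglelefteq p\Rightarrow\top$, $p\Rightarrow(q\wedge r)\trianglelefteq(p\Rightarrow q)\wedge(p\Rightarrow r)$, $(p\Rightarrow q)\wedge(p\Rightarrow r)\trianglelefteq p\Rightarrow(q\wedge r)$, and closed under: from $p\trianglelefteq q,q\trianglelefteq r$ infer $p\trianglelefteq r$; from $r\trianglelefteq p,r\trianglelefteq q$ infer $r\trianglelefteq p\wedge q$; from $p\trianglelefteq r,q\trianglelefteq r$ infer $p\vee q\trianglelefteq r$; from $p\trianglelefteq q$ and $q\trianglelefteq p$ infer $p\Rightarrow r\trianglelefteq q\Rightarrow r$ and $r\Rightarrow p\trianglelefteq r\Rightarrow q$. A meet-semilattice $(X,1,\curlywedge)$ has top $1$ and order $x\preccurlyeq y$ iff $x\curlywedge y=x$; a filter is an upward closed subset closed under finite meets; $\mathcal F(X)$ is the set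 of filters. A selection L-frame is $(X,1,\curlywedge,s)$ with $s:X\times\mathcal F(X)\to\mathcal F(X)$ such that for all $x,y,z\in X$, $a\in\mathcal F(X)$: $s(1,a)=\{1\}$; $x\preccurlyeq y$ implies $s(y,a)\subseteq s(x,a)$; if $z\in s(x\curlywedge y,a)$ there are $u\in s(x,a)$, $v\in s(y,a)$ with $u\curlywedge v\preccurlyeq z$. A valuation $V$ assigns a filter to each letter; truth: $x\Vdash p$ iff $x\in V(p)$; $\top$ always; $x\Vdash\bot$ iff $x=1$; $\wedge$ pointwise; $x\Vdash\phi\vee\psi$ iff there are $y\Vdash\phi$, $z\Vdash\psi$ with $y\curlywedge z\preccurlyeq x$; $x\Vdash\phi\Rightarrow\psi$ iff $s(x,[\![\phi]\!])\subseteq[\![\psi]\!]$ where $[\![\phi]\!]$ is the truth set. A frame validates $\phi\trianglelefteq\psi$ if $[\![\phi]\!]\subseteq[\![\psi]\!]$ for every valuation. -}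

module Defs where

open import Level using (0ℓ)
open import Data.Nat using (ℕ)
open import Data.Unit using (⊤; tt)
open import Data.Product using (Σ; ∃₂; _×_; _,_; proj₁; proj₂)
open import Algebra.Lattice.Bundles using (BoundedMeetSemilattice; Semilattice)
import Relation.Binary.Construct.NaturalOrder.Left as LeftNaturalOrder
open import Relation.Binary.Lattice using (Infimum)

Letter : Set
Letter = ℕ

infixr 7 _∧ᶠ_
infixr 6 _∨ᶠ_
infixr 5 _⇒ᶠ_

data Form : Set where
  var  : Letter → Form
  ⊤ᶠ   : Form
  ⊥ᶠ   : Form
  _∧ᶠ_ : Form → Form → Form
  _∨ᶠ_ : Form → Form → Form
  _⇒ᶠ_ : Form → Form → Form

_[_] : Form → (Letter → Form) → Form
var p [ σ ]     = σ p
⊤ᶠ [ σ ]        = ⊤ᶠ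
⊥ᶠ [ σ ]        = ⊥ᶠ
(φ ∧ᶠ ψ) [ σ ]  = (φ [ σ ]) ∧ᶠ (ψ [ σ ])
(φ ∨ᶠ ψ) [ σ ]  = (φ [ σ ]) ∨ᶠ (ψ [ σ ])
(φ ⇒ᶠ ψ) [ σ ]  = (φ [ σ ]) ⇒ᶠ (ψ [ σ ])

p q r : Form
p = var 0
q = var 1
r = var 2

-- The logic CL: CL φ ψ means the consequence pair φ ⊴ ψ belongs to CL.
-- It is the least set of pairs containing the axioms (stated for the
-- letters p,q,r), closed under uniform substitution and the rules.

data CL : Form → Form → Set where
  usubst  : ∀ {φ ψ} (σ : Letter → Form) → CL φ ψ → CL (φ [ σ ]) (ψ [ σ ])
  ax-top  : CL p ⊤ᶠ
  ax-bot  : CL ⊥ᶠ p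
  ax-refl : CL p p
  ax-∧₁   : CL (p ∧ᶠ q) p
  ax-∧₂   : CL (p ∧ᶠ q) q
  ax-∨₁   : CL p (p ∨ᶠ q)
  ax-∨₂   : CL q (p ∨ᶠ q)
  ax-⇒⊤   : CL ⊤ᶠ (p ⇒ᶠ ⊤ᶠ)
  ax-⇒∧₁  : CL (p ⇒ᶠ (q ∧ᶠ r)) ((p ⇒ᶠ q) ∧ᶠ (p ⇒ᶠ r))
  ax-⇒∧₂  : CL ((p ⇒ᶠ q) ∧ᶠ (p ⇒ᶠ r)) (p ⇒ᶠ (q ∧ᶠ r))
  cut     : ∀ {φ ψ χ} → CL φ ψ → CL ψ χ → CL φ χ
  ∧-intro : ∀ {φ ψ χ} → CL χ φ → CL χ ψ → CL χ (φ ∧ᶠ ψ)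
  ∨-elim  : ∀ {φ ψ χ} → CL φ χ → CL ψ χ → CL (φ ∨ᶠ ψ) χ
  ⇒-congˡ : ∀ {φ ψ χ} → CL φ ψ → CL ψ φ → CL (φ ⇒ᶠ χ) (ψ ⇒ᶠ χ)
  ⇒-congʳ : ∀ {φ ψ χ} → CL φ ψ → CL ψ φ → CL (χ ⇒ᶠ φ) (χ ⇒ᶠ ψ)

module OnSemilattice (L : BoundedMeetSemilattice 0ℓ 0ℓ) where
  open BoundedMeetSemilattice L renaming (⊤ to 𝟏) public

  -- x ≼ y  iff  x ≈ x ∧ y  (left natural order)
  _≼_ : Carrier → Carrier → Set
  _≼_ = LeftNaturalOrder._≤_ _≈_ _∧_

  record Filter : Set₁ where
    field
      pred  : Carrier → Set
      up    : ∀ {x y} → x ≼ y → pred x → pred y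
      top   : pred 𝟏
      meet  : ∀ {x y} → pred x → pred y → pred (x ∧ y)
  open Filter public

  _⊆_ : Filter → Filter → Set
  a ⊆ b = ∀ z → pred a z → pred b z

  record IsSelection (s : Carrier → Filter → Filter) : Set₁ where
    field
      s-top₁ : ∀ a z → pred (s 𝟏 a) z → z ≈ 𝟏
      s-top₂ : ∀ a z → z ≈ 𝟏 → pred (s 𝟏 a) z
      s-anti : ∀ {x y} a → x ≼ y → s y a ⊆ s x a
      s-meet : ∀ x y a z → pred (s (x ∧ y) a) z →
               ∃₂ λ u v → pred (s x a) u × pred (s y a) v × ((u ∧ v) ≼ z)
      -- s is a function of the filter as a set (extensionality)
      s-ext  : ∀ x a b → a ⊆ b → b ⊆ a → s x a ⊆ s x b

record SelectionLFrame : Set₁ where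
  field
    L : BoundedMeetSemilattice 0ℓ 0ℓ
  open OnSemilattice L
  field
    s           : Carrier → Filter → Filter
    isSelection : IsSelection s

module Semantics (F : SelectionLFrame) where
  open SelectionLFrame F
  open OnSemilattice L
  open IsSelection isSelection
  import Algebra.Lattice.Properties.Semilattice as SP
  open SP semilattice using (poset)
  open import Relation.Binary.Bundles using (Poset)
  open Poset poset using () renaming (reflexive to ≼-reflexive; antisym to ≼-antisym; trans to ≼-trans; refl to ≼-refl)

  private
    inf : Infimum _≼_ _∧_
    inf = LeftNaturalOrder.infimum _≈_ _∧_ (Semilattice.isSemilattice semilattice)

    ≼𝟏 : ∀ x → x ≼ 𝟏
    ≼𝟏 x = sym (identityʳ x)

  Valuation : Set₁
  Valuation = Letter → Filter

  module _ (V : Valuation) where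
    mutual
      infix 4 _⊩_
      _⊩_ : Carrier → Form → Set
      x ⊩ var n    = pred (V n) x
      x ⊩ ⊤ᶠ       = ⊤
      x ⊩ ⊥ᶠ       = x ≈ 𝟏
      x ⊩ φ ∧ᶠ ψ   = (x ⊩ φ) × (x ⊩ ψ)
      x ⊩ φ ∨ᶠ ψ   = ∃₂ λ y z → (y ⊩ φ) × (z ⊩ ψ) × ((y ∧ z) ≼ x)
      x ⊩ φ ⇒ᶠ ψ   = ∀ z → pred (s x ⟦ φ ⟧) z → z ⊩ ψ

      ⟦_⟧ : Form → Filter
      ⟦ φ ⟧ = record { pred = _⊩ φ ; up = ⊩-up φ ; top = ⊩-top φ ; meet = ⊩-meet φ }

      ⊩-up : ∀ φ {x y} → x ≼ y → x ⊩ φ → y ⊩ φ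
      ⊩-up (var n) x≼y h = up (V n) x≼y h
      ⊩-up ⊤ᶠ x≼y h = tt
      ⊩-up ⊥ᶠ {x} {y} x≼y h =
        ≼-antisym (≼𝟏 y) (≼-trans (≼-reflexive (sym h)) x≼y)
      ⊩-up (φ ∧ᶠ ψ) x≼y (h₁ , h₂) = ⊩-up φ x≼y h₁ , ⊩-up ψ x≼y h₂
      ⊩-up (φ ∨ᶠ ψ) x≼y (u , v , h₁ , h₂ , uv) = u , v , h₁ , h₂ , ≼-trans uv x≼y
      ⊩-up (φ ⇒ᶠ ψ) x≼y h z hz = h z (s-anti ⟦ φ ⟧ x≼y z hz)

      ⊩-top : ∀ φ → 𝟏 ⊩ φ
      ⊩-top (var n) = top (V n)
      ⊩-top ⊤ᶠ = tt
      ⊩-top ⊥ᶠ = refl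
      ⊩-top (φ ∧ᶠ ψ) = ⊩-top φ , ⊩-top ψ
      ⊩-top (φ ∨ᶠ ψ) = 𝟏 , 𝟏 , ⊩-top φ , ⊩-top ψ , ≼𝟏 (𝟏 ∧ 𝟏)
      ⊩-top (φ ⇒ᶠ ψ) z hz = ⊩-up ψ (≼-reflexive (sym (s-top₁ ⟦ φ ⟧ z hz))) (⊩-top ψ)

      ⊩-meet : ∀ φ {x y} → x ⊩ φ → y ⊩ φ → (x ∧ y) ⊩ φ
      ⊩-meet (var n) h k = meet (V n) h k
      ⊩-meet ⊤ᶠ h k = tt
      ⊩-meet ⊥ᶠ h k = trans (∧-cong h k) (identityˡ 𝟏)
      ⊩-meet (φ ∧ᶠ ψ) (h₁ , h₂) (k₁ , k₂) = ⊩-meet φ h₁ k₁ , ⊩-meet ψ h₂ k₂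
      ⊩-meet (φ ∨ᶠ ψ) {x} {x'} (y , z , h₁ , h₂ , yz) (y' , z' , k₁ , k₂ , yz') =
        (y ∧ y') , (z ∧ z') , ⊩-meet φ h₁ k₁ , ⊩-meet ψ h₂ k₂ ,
        glb (≼-trans (glb (≼-trans l₁ (proj₁ (inf y y'))) (≼-trans l₂ (proj₁ (inf z z')))) yz)
            (≼-trans (glb (≼-trans l₁ (proj₁ (proj₂ (inf y y')))) (≼-trans l₂ (proj₁ (proj₂ (inf z z'))))) yz')
        where
          glb : ∀ {a b c} → a ≼ b → a ≼ c → a ≼ (b ∧ c)
          glb {a} {b} {c} = proj₂ (proj₂ (inf b c)) a
          l₁ = proj₁ (inf (y ∧ y') (z ∧ z'))
          l₂ = proj₁ (proj₂ (inf (y ∧ y') (z ∧ z')))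
      ⊩-meet (φ ⇒ᶠ ψ) {x} {y} h k z hz with s-meet x y ⟦ φ ⟧ z hz
      ... | u , v , hu , hv , uv = ⊩-up ψ uv (⊩-meet ψ (h u hu) (k v hv))

  Validates : Form → Form → Set₁
  Validates φ ψ = ∀ (V : Valuation) (x : Carrier) → _⊩_ V x φ → _⊩_ V x ψ

-- Soundness is a rule-by-rule check; the only delicate cases are uniform
-- substitution and ⇒-congˡ, which need that s(x,a)
-- depends on the filter a only as a set.
--
-- Completeness goes through a canonical frame whose points are theories
-- (sets of formulas closed under CL-consequence and ∧), ordered by
-- inclusion, with the set of all formulas as top.  The selection function
-- sends a theory T and the filter of theories containing φ to the filter of
-- theories extending {χ | φ ⇒ χ ∈ T}; the axioms ax-⇒∧ and ax-⇒⊤ say exactly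
-- that this set is again a theory.  A truth lemma (T ⊩ φ iff φ ∈ T) then
-- shows that the canonical frame refutes every pair outside CL.
module Submission where

open import Level using (0ℓ)
open import Data.Nat using (suc)
open import Data.Unit using (tt)
open import Data.Product using (Σ; ∃₂; _×_; _,_; proj₁; proj₂; swap; assocʳ′; assocˡ′)
open import Data.Product.Function.NonDependent.Propositional using (_×-⇔_)
open import Data.Sum using (_⊎_; inj₁; inj₂)
open import Function.Bundles using (_⇔_; mk⇔; Equivalence)
import Function.Properties.Equivalence as ⇔
open import Algebra.Lattice.Bundles using (BoundedMeetSemilattice)
open import Relation.Binary.Bundles using (Poset)
import Algebra.Lattice.Properties.Semilattice as SemilatticeProperties

open import Defs

open Equivalence using (to; from)

instantiate : Form → Form → Form → Letter → Form
instantiate a b c 0             = a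
instantiate a b c 1             = b
instantiate a b c (suc (suc _)) = c

CL-refl : ∀ φ → CL φ φ
CL-refl φ = usubst (instantiate φ φ φ) ax-refl

CL-⊤ : ∀ φ → CL φ ⊤ᶠ
CL-⊤ φ = usubst (instantiate φ φ φ) ax-top

CL-⊥ : ∀ φ → CL ⊥ᶠ φ
CL-⊥ φ = usubst (instantiate φ φ φ) ax-bot

∧-elimˡ : ∀ φ ψ → CL (φ ∧ᶠ ψ) φ
∧-elimˡ φ ψ = usubst (instantiate φ ψ φ) ax-∧₁

∧-elimʳ : ∀ φ ψ → CL (φ ∧ᶠ ψ) ψ
∧-elimʳ φ ψ = usubst (instantiate φ ψ φ) ax-∧₂

∨-introˡ : ∀ φ ψ → CL φ (φ ∨ᶠ ψ)
∨-introˡ φ ψ = usubst (instantiate φ ψ φ) ax-∨₁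

∨-introʳ : ∀ φ ψ → CL ψ (φ ∨ᶠ ψ)
∨-introʳ φ ψ = usubst (instantiate φ ψ φ) ax-∨₂

⇒-⊤ : ∀ φ → CL ⊤ᶠ (φ ⇒ᶠ ⊤ᶠ)
⇒-⊤ φ = usubst (instantiate φ φ φ) ax-⇒⊤

⇒-distrib-∧ : ∀ φ ψ χ → CL (φ ⇒ᶠ (ψ ∧ᶠ χ)) ((φ ⇒ᶠ ψ) ∧ᶠ (φ ⇒ᶠ χ))
⇒-distrib-∧ φ ψ χ = usubst (instantiate φ ψ χ) ax-⇒∧₁

⇒-collect-∧ : ∀ φ ψ χ → CL ((φ ⇒ᶠ ψ) ∧ᶠ (φ ⇒ᶠ χ)) (φ ⇒ᶠ (ψ ∧ᶠ χ))
⇒-collect-∧ φ ψ χ = usubst (instantiate φ ψ χ) ax-⇒∧₂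

-- ψ and ψ ∧ ψ' are interderivable when CL ψ ψ', so ⇒-congʳ applies.
⇒-monoʳ : ∀ {φ ψ ψ'} → CL ψ ψ' → CL (φ ⇒ᶠ ψ) (φ ⇒ᶠ ψ')
⇒-monoʳ {φ} {ψ} {ψ'} ψ⊴ψ' =
  cut (⇒-congʳ (∧-intro (CL-refl ψ) ψ⊴ψ') (∧-elimˡ ψ ψ'))
      (cut (⇒-distrib-∧ φ ψ ψ') (∧-elimʳ (φ ⇒ᶠ ψ) (φ ⇒ᶠ ψ')))

module Soundness (F : SelectionLFrame) where
  open SelectionLFrame F
  open OnSemilattice L
  open IsSelection isSelection
  open Semantics F
  open Poset (SemilatticeProperties.poset semilattice) using () renaming (reflexive to ≼-reflexive)

  _⊙_ : Valuation → (Letter → Form) → Valuation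
  (V ⊙ σ) n = ⟦_⟧ V (σ n)

  ⊩-[] : ∀ V σ φ x → _⊩_ V x (φ [ σ ]) ⇔ _⊩_ (V ⊙ σ) x φ
  ⊩-[] V σ (var n)  x = ⇔.refl
  ⊩-[] V σ ⊤ᶠ       x = ⇔.refl
  ⊩-[] V σ ⊥ᶠ       x = ⇔.refl
  ⊩-[] V σ (φ ∧ᶠ ψ) x = ⊩-[] V σ φ x ×-⇔ ⊩-[] V σ ψ x
  ⊩-[] V σ (φ ∨ᶠ ψ) x = mk⇔
    (λ (y , z , y⊩ , z⊩ , y∧z≼x) → y , z , to (⊩-[] V σ φ y) y⊩ , to (⊩-[] V σ ψ z) z⊩ , y∧z≼x)
    (λ (y , z , y⊩ , z⊩ , y∧z≼x) → y , z , from (⊩-[] V σ φ y) y⊩ , from (⊩-[] V σ ψ z) z⊩ , y∧z≼x)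
  ⊩-[] V σ (φ ⇒ᶠ ψ) x = mk⇔
    (λ x⊩ z z∈s → to (⊩-[] V σ ψ z) (x⊩ z (s-ext x (⟦_⟧ (V ⊙ σ) φ) (⟦_⟧ V (φ [ σ ])) ⟦φ⟧⊆⟦φσ⟧ ⟦φσ⟧⊆⟦φ⟧ z z∈s)))
    (λ x⊩ z z∈s → from (⊩-[] V σ ψ z) (x⊩ z (s-ext x (⟦_⟧ V (φ [ σ ])) (⟦_⟧ (V ⊙ σ) φ) ⟦φσ⟧⊆⟦φ⟧ ⟦φ⟧⊆⟦φσ⟧ z z∈s)))
    where
    ⟦φ⟧⊆⟦φσ⟧ : ⟦_⟧ (V ⊙ σ) φ ⊆ ⟦_⟧ V (φ [ σ ])
    ⟦φ⟧⊆⟦φσ⟧ w = from (⊩-[] V σ φ w)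
    ⟦φσ⟧⊆⟦φ⟧ : ⟦_⟧ V (φ [ σ ]) ⊆ ⟦_⟧ (V ⊙ σ) φ
    ⟦φσ⟧⊆⟦φ⟧ w = to (⊩-[] V σ φ w)

  sound : ∀ {φ ψ} → CL φ ψ → Validates φ ψ
  sound (usubst {φ} {ψ} σ φ⊴ψ) V x x⊩ =
    from (⊩-[] V σ ψ x) (sound φ⊴ψ (V ⊙ σ) x (to (⊩-[] V σ φ x) x⊩))
  sound ax-top    V x _        = tt
  sound ax-bot    V x x≈𝟏      = up (V 0) (≼-reflexive (sym x≈𝟏)) (top (V 0))
  sound ax-refl   V x x⊩       = x⊩
  sound ax-∧₁     V x (x⊩ , _) = x⊩
  sound ax-∧₂     V x (_ , x⊩) = x⊩
  sound ax-∨₁     V x x⊩       = x , 𝟏 , x⊩ , top (V 1) , ≼-reflexive (identityʳ x)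
  sound ax-∨₂     V x x⊩       = 𝟏 , x , top (V 0) , x⊩ , ≼-reflexive (identityˡ x)
  sound ax-⇒⊤     V x _ z _    = tt
  sound ax-⇒∧₁    V x x⊩       = (λ z z∈s → proj₁ (x⊩ z z∈s)) , (λ z z∈s → proj₂ (x⊩ z z∈s))
  sound ax-⇒∧₂    V x (x⊩ , x⊩′) z z∈s = x⊩ z z∈s , x⊩′ z z∈s
  sound (cut φ⊴ψ ψ⊴χ) V x x⊩ = sound ψ⊴χ V x (sound φ⊴ψ V x x⊩)
  sound (∧-intro χ⊴φ χ⊴ψ) V x x⊩ = sound χ⊴φ V x x⊩ , sound χ⊴ψ V x x⊩
  sound (∨-elim {χ = χ} φ⊴χ ψ⊴χ) V x (y , z , y⊩ , z⊩ , y∧z≼x) =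
    ⊩-up V χ y∧z≼x (⊩-meet V χ (sound φ⊴χ V y y⊩) (sound ψ⊴χ V z z⊩))
  sound (⇒-congˡ {φ} {ψ} φ⊴ψ ψ⊴φ) V x x⊩ z z∈s =
    x⊩ z (s-ext x (⟦_⟧ V ψ) (⟦_⟧ V φ) (λ w → sound ψ⊴φ V w) (λ w → sound φ⊴ψ V w) z z∈s)
  sound (⇒-congʳ φ⊴ψ _) V x x⊩ z z∈s = sound φ⊴ψ V z (x⊩ z z∈s)

-- Codes for the theories the truth lemma needs; φ ⇒⁻¹ T stands for
-- {χ | φ ⇒ χ ∈ T}.  Codes are identified when they have the same members.
infixr 6 _⇒⁻¹_
infixr 5 _⊓_

data Theory : Set where
  ⟨_⟩   : Form → Theory
  _⇒⁻¹_ : Form → Theory → Theory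
  _⊓_   : Theory → Theory → Theory

infix 4 _∈_ _⊆ᵗ_ _≐_

_∈_ : Form → Theory → Set
χ ∈ ⟨ φ ⟩    = CL φ χ
χ ∈ φ ⇒⁻¹ T  = φ ⇒ᶠ χ ∈ T
χ ∈ T ⊓ U    = (χ ∈ T) × (χ ∈ U)

_⊆ᵗ_ : Theory → Theory → Set
T ⊆ᵗ U = ∀ χ → χ ∈ T → χ ∈ U

record _≐_ (T U : Theory) : Set where
  constructor same-members
  field members : ∀ χ → χ ∈ T ⇔ χ ∈ U
open _≐_

∈-mono : ∀ T {χ χ′} → CL χ χ′ → χ ∈ T → χ′ ∈ T
∈-mono ⟨ φ ⟩     χ⊴χ′ χ∈ = cut χ∈ χ⊴χ′
∈-mono (φ ⇒⁻¹ T) χ⊴χ′ χ∈ = ∈-mono T (⇒-monoʳ χ⊴χ′) χ∈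
∈-mono (T ⊓ U)   χ⊴χ′ (χ∈T , χ∈U) = ∈-mono T χ⊴χ′ χ∈T , ∈-mono U χ⊴χ′ χ∈U

∈-∧ : ∀ T {χ χ′} → χ ∈ T → χ′ ∈ T → χ ∧ᶠ χ′ ∈ T
∈-∧ ⟨ φ ⟩     χ∈ χ′∈ = ∧-intro χ∈ χ′∈
∈-∧ (φ ⇒⁻¹ T) {χ} {χ′} χ∈ χ′∈ = ∈-mono T (⇒-collect-∧ φ χ χ′) (∈-∧ T χ∈ χ′∈)
∈-∧ (T ⊓ U)   (χ∈T , χ∈U) (χ′∈T , χ′∈U) = ∈-∧ T χ∈T χ′∈T , ∈-∧ U χ∈U χ′∈U

⊤∈ : ∀ T → ⊤ᶠ ∈ T
⊤∈ ⟨ φ ⟩     = CL-⊤ φ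
⊤∈ (φ ⇒⁻¹ T) = ∈-mono T (⇒-⊤ φ) (⊤∈ T)
⊤∈ (T ⊓ U)   = ⊤∈ T , ⊤∈ U

whole : Theory
whole = ⟨ ⊥ᶠ ⟩

∈-whole : ∀ χ → χ ∈ whole
∈-whole = CL-⊥

⊆ᵗ-whole⇒≐ : ∀ {T} → whole ⊆ᵗ T → T ≐ whole
⊆ᵗ-whole⇒≐ whole⊆T = same-members λ χ → mk⇔ (λ _ → ∈-whole χ) (whole⊆T χ)

⊓-cong : ∀ {T T′ U U′} → T ≐ T′ → U ≐ U′ → T ⊓ U ≐ T′ ⊓ U′
⊓-cong T≐T′ U≐U′ = same-members λ χ → members T≐T′ χ ×-⇔ members U≐U′ χ

theoryLattice : BoundedMeetSemilattice 0ℓ 0ℓ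
theoryLattice = record
  { Carrier = Theory
  ; _≈_     = _≐_
  ; _∧_     = _⊓_
  ; ⊤       = whole
  ; isBoundedMeetSemilattice = record
    { isCommutativeMonoid = record
      { isMonoid = record
        { isSemigroup = record
          { isMagma = record
            { isEquivalence = record
              { refl  = same-members λ χ → ⇔.refl
              ; sym   = λ T≐U → same-members λ χ → ⇔.sym (members T≐U χ)
              ; trans = λ T≐U U≐W → same-members λ χ → ⇔.trans (members T≐U χ) (members U≐W χ)
              }
            ; ∙-cong = ⊓-cong
            }
          ; assoc = λ T U W → same-members λ χ → mk⇔ assocʳ′ assocˡ′
          }
        ; identity = (λ T → same-members λ χ → mk⇔ proj₂ (∈-whole χ ,_))
                   , (λ T → same-members λ χ → mk⇔ proj₁ (_, ∈-whole χ))
        }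
      ; comm = λ T U → same-members λ χ → mk⇔ swap swap
      }
    ; idem = λ T → same-members λ χ → mk⇔ proj₁ (λ χ∈ → χ∈ , χ∈)
    }
  }

open OnSemilattice theoryLattice using (Filter; pred; _≼_) renaming (_⊆_ to _⊆ᶠ_)

≼⇒⊆ᵗ : ∀ {T U} → T ≼ U → T ⊆ᵗ U
≼⇒⊆ᵗ T≼U χ χ∈T = proj₂ (to (members T≼U χ) χ∈T)

⊆ᵗ⇒≼ : ∀ {T U} → T ⊆ᵗ U → T ≼ U
⊆ᵗ⇒≼ T⊆U = same-members λ χ → mk⇔ (λ χ∈T → χ∈T , T⊆U χ χ∈T) proj₁

containing : Form → Filter
containing φ = record
  { pred = φ ∈_
  ; up   = λ T≼U → ≼⇒⊆ᵗ T≼U φ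
  ; top  = ∈-whole φ
  ; meet = _,_
  }

infix 4 _≐ᶠ_

_≐ᶠ_ : Filter → Filter → Set
a ≐ᶠ b = (a ⊆ᶠ b) × (b ⊆ᶠ a)

-- ⟨ φ ⟩ is the least theory containing φ.
containing-≐⇒CL : ∀ a {φ φ′} → a ≐ᶠ containing φ → a ≐ᶠ containing φ′ → CL φ φ′
containing-≐⇒CL a {φ} (_ , φ-in-a) (a-has-φ′ , _) = a-has-φ′ ⟨ φ ⟩ (φ-in-a ⟨ φ ⟩ (CL-refl φ))

⇒⁻¹-cong : ∀ T {φ φ′} → CL φ φ′ → CL φ′ φ → φ ⇒⁻¹ T ⊆ᵗ φ′ ⇒⁻¹ T
⇒⁻¹-cong T φ⊴φ′ φ′⊴φ χ = ∈-mono T (⇒-congˡ φ⊴φ′ φ′⊴φ)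

-- Filters not of the form `containing φ` are irrelevant to the truth lemma;
-- they are sent to the filter {whole}.  By containing-≐⇒CL the choice of φ
-- does not matter up to ⇒⁻¹-cong.
Selected : Theory → Filter → Theory → Set
Selected T a U = (whole ⊆ᵗ U) ⊎ Σ Form λ φ → (a ≐ᶠ containing φ) × (φ ⇒⁻¹ T ⊆ᵗ U)

Selected-up : ∀ T a {U W} → U ≼ W → Selected T a U → Selected T a W
Selected-up T a U≼W (inj₁ whole⊆U) = inj₁ λ χ χ∈ → ≼⇒⊆ᵗ U≼W χ (whole⊆U χ χ∈)
Selected-up T a U≼W (inj₂ (φ , a≐ , φT⊆U)) = inj₂ (φ , a≐ , λ χ χ∈ → ≼⇒⊆ᵗ U≼W χ (φT⊆U χ χ∈))

Selected-⊓ : ∀ T a {U W} → Selected T a U → Selected T a W → Selected T a (U ⊓ W)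
Selected-⊓ T a (inj₁ whole⊆U) (inj₁ whole⊆W) =
  inj₁ λ χ χ∈ → whole⊆U χ χ∈ , whole⊆W χ χ∈
Selected-⊓ T a (inj₁ whole⊆U) (inj₂ (φ , a≐ , φT⊆W)) =
  inj₂ (φ , a≐ , λ χ χ∈ → whole⊆U χ (∈-whole χ) , φT⊆W χ χ∈)
Selected-⊓ T a (inj₂ (φ , a≐ , φT⊆U)) (inj₁ whole⊆W) =
  inj₂ (φ , a≐ , λ χ χ∈ → φT⊆U χ χ∈ , whole⊆W χ (∈-whole χ))
Selected-⊓ T a (inj₂ (φ , a≐ , φT⊆U)) (inj₂ (φ′ , a≐′ , φ′T⊆W)) =
  inj₂ (φ , a≐ , λ χ χ∈ → φT⊆U χ χ∈ , φ′T⊆W χ (⇒⁻¹-cong T φ⊴φ′ φ′⊴φ χ χ∈))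
  where
  φ⊴φ′ = containing-≐⇒CL a a≐ a≐′
  φ′⊴φ = containing-≐⇒CL a a≐′ a≐

select : Theory → Filter → Filter
select T a = record
  { pred = Selected T a
  ; up   = λ {U} {W} → Selected-up T a {U} {W}
  ; top  = inj₁ λ χ _ → ∈-whole χ
  ; meet = λ {U} {W} → Selected-⊓ T a {U} {W}
  }

Selected-whole⇒≐ : ∀ a U → Selected whole a U → U ≐ whole
Selected-whole⇒≐ a U (inj₁ whole⊆U) = ⊆ᵗ-whole⇒≐ whole⊆U
Selected-whole⇒≐ a U (inj₂ (φ , _ , φwhole⊆U)) =
  ⊆ᵗ-whole⇒≐ λ χ _ → φwhole⊆U χ (∈-whole (φ ⇒ᶠ χ))

select-anti : ∀ {T U} a → T ≼ U → select U a ⊆ᶠ select T a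
select-anti a T≼U W (inj₁ whole⊆W) = inj₁ whole⊆W
select-anti a T≼U W (inj₂ (φ , a≐ , φU⊆W)) =
  inj₂ (φ , a≐ , λ χ χ∈ → φU⊆W χ (≼⇒⊆ᵗ T≼U (φ ⇒ᶠ χ) χ∈))

Selected-split : ∀ T U a W → Selected (T ⊓ U) a W →
  ∃₂ λ T′ U′ → Selected T a T′ × Selected U a U′ × ((T′ ⊓ U′) ≼ W)
Selected-split T U a W (inj₁ whole⊆W) =
  whole , whole , inj₁ (λ _ χ∈ → χ∈) , inj₁ (λ _ χ∈ → χ∈) , ⊆ᵗ⇒≼ λ χ _ → whole⊆W χ (∈-whole χ)
Selected-split T U a W (inj₂ (φ , a≐ , φTU⊆W)) =
  φ ⇒⁻¹ T , φ ⇒⁻¹ U , inj₂ (φ , a≐ , λ _ χ∈ → χ∈) , inj₂ (φ , a≐ , λ _ χ∈ → χ∈) , ⊆ᵗ⇒≼ φTU⊆W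

select-ext : ∀ T a b → a ⊆ᶠ b → b ⊆ᶠ a → select T a ⊆ᶠ select T b
select-ext T a b a⊆b b⊆a U (inj₁ whole⊆U) = inj₁ whole⊆U
select-ext T a b a⊆b b⊆a U (inj₂ (φ , (a⊆φ , φ⊆a) , φT⊆U)) =
  inj₂ (φ , ((λ W W∈ → a⊆φ W (b⊆a W W∈)) , (λ W W∈ → a⊆b W (φ⊆a W W∈))) , φT⊆U)

canonical : SelectionLFrame
canonical = record
  { L = theoryLattice
  ; s = select
  ; isSelection = record
    { s-top₁ = Selected-whole⇒≐
    ; s-top₂ = λ a U U≐whole → inj₁ λ χ → from (members U≐whole χ)
    ; s-anti = select-anti
    ; s-meet = Selected-split
    ; s-ext  = select-ext
    }
  }

module Completeness where
  open Semantics canonical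

  V-canonical : Valuation
  V-canonical n = containing (var n)

  infix 4 _⊩ᶜ_

  _⊩ᶜ_ : Theory → Form → Set
  _⊩ᶜ_ = _⊩_ V-canonical

  mutual
    truth-lemma : ∀ φ T → T ⊩ᶜ φ ⇔ φ ∈ T
    truth-lemma (var n) T = ⇔.refl
    truth-lemma ⊤ᶠ T = mk⇔ (λ _ → ⊤∈ T) (λ _ → tt)
    truth-lemma ⊥ᶠ T = mk⇔ (λ T≐whole → from (members T≐whole ⊥ᶠ) (∈-whole ⊥ᶠ))
                           (λ ⊥∈T → ⊆ᵗ-whole⇒≐ λ χ _ → ∈-mono T (CL-⊥ χ) ⊥∈T)
    truth-lemma (φ ∧ᶠ ψ) T = mk⇔
      (λ (T⊩φ , T⊩ψ) → ∈-∧ T (to (truth-lemma φ T) T⊩φ) (to (truth-lemma ψ T) T⊩ψ))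
      (λ φ∧ψ∈T → from (truth-lemma φ T) (∈-mono T (∧-elimˡ φ ψ) φ∧ψ∈T)
               , from (truth-lemma ψ T) (∈-mono T (∧-elimʳ φ ψ) φ∧ψ∈T))
    truth-lemma (φ ∨ᶠ ψ) T = mk⇔
      (λ (U , W , U⊩φ , W⊩ψ , U⊓W≼T) → ≼⇒⊆ᵗ U⊓W≼T (φ ∨ᶠ ψ)
        ( ∈-mono U (∨-introˡ φ ψ) (to (truth-lemma φ U) U⊩φ)
        , ∈-mono W (∨-introʳ φ ψ) (to (truth-lemma ψ W) W⊩ψ)))
      (λ φ∨ψ∈T → ⟨ φ ⟩ , ⟨ ψ ⟩
        , from (truth-lemma φ ⟨ φ ⟩) (CL-refl φ)
        , from (truth-lemma ψ ⟨ ψ ⟩) (CL-refl ψ)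
        , ⊆ᵗ⇒≼ λ χ (φ⊴χ , ψ⊴χ) → ∈-mono T (∨-elim φ⊴χ ψ⊴χ) φ∨ψ∈T)
    truth-lemma (φ ⇒ᶠ ψ) T = mk⇔
      (λ T⊩φ⇒ψ → to (truth-lemma ψ (φ ⇒⁻¹ T))
                    (T⊩φ⇒ψ (φ ⇒⁻¹ T) (inj₂ (φ , truth-set≐containing φ , λ _ χ∈ → χ∈))))
      sufficient
      where
      sufficient : φ ⇒ᶠ ψ ∈ T → T ⊩ᶜ φ ⇒ᶠ ψ
      sufficient φ⇒ψ∈T U (inj₁ whole⊆U) = from (truth-lemma ψ U) (whole⊆U ψ (∈-whole ψ))
      sufficient φ⇒ψ∈T U (inj₂ (φ′ , ⟦φ⟧≐ , φ′T⊆U)) =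
        from (truth-lemma ψ U) (φ′T⊆U ψ (⇒⁻¹-cong T φ⊴φ′ φ′⊴φ ψ φ⇒ψ∈T))
        where
        φ⊴φ′ = containing-≐⇒CL (⟦_⟧ V-canonical φ) (truth-set≐containing φ) ⟦φ⟧≐
        φ′⊴φ = containing-≐⇒CL (⟦_⟧ V-canonical φ) ⟦φ⟧≐ (truth-set≐containing φ)

    truth-set≐containing : ∀ φ → ⟦_⟧ V-canonical φ ≐ᶠ containing φ
    truth-set≐containing φ = (λ T → to (truth-lemma φ T)) , (λ T → from (truth-lemma φ T))

  complete : ∀ {φ ψ} → Semantics.Validates canonical φ ψ → CL φ ψ
  complete {φ} {ψ} valid =
    to (truth-lemma ψ ⟨ φ ⟩) (valid V-canonical ⟨ φ ⟩ (from (truth-lemma φ ⟨ φ ⟩) (CL-refl φ)))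

theorem4p12 : (φ ψ : Form) →
    CL φ ψ ⇔ ((F : SelectionLFrame) → Semantics.Validates F φ ψ)
theorem4p12 φ ψ = mk⇔ (λ φ⊴ψ F → Soundness.sound F φ⊴ψ) (λ valid → Completeness.complete (valid canonical))
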